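{- Let $G$ be a graph on $n$ vertices with minimum degree $\delta(G)\geq n/2$, and let $P_0$ be a path in $G$. Then there exist two vertices $a,b\in V(P_0)$ and a path $P^*$ in $G$ with endpoints $a$ and $b$ such that: (i) $V(P^*)=V(P_0)$; (ii) $|E(P_0)\,\Delta\, E(P^*)|\leq 4$; (iii) either $ab\in E(G)$ and the cycle obtained by adding the edge $ab$ to $P^*$ is a Hamilton cycle of $G$, or $G$ contains an edge between $\{a,b\}$ and $V(G)\setminus V(P^*)$.
   Context: All graphs are finite and simple. $\Delta$ denotes symmetric difference of edge sets. -}

module Defs where

open import Data.Nat using (ℕ; _≤_; _<?_; _*_)
open import Data.Fin using (Fin; toℕ; _≟_)
open import Data.Bool using (Bool; true; false; _∧_; _∨_; _xor_)
open import Data.List using (List; []; _∷_; length; filter; filterᵇ; allFin; concatMap; map; head; last)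
open import Data.List.Membership.Propositional using (_∈_; _∉_)
open import Data.List.Relation.Unary.Unique.Propositional using (Unique)
open import Data.List.Relation.Unary.Linked using (Linked)
open import Data.Maybe using (Maybe; just)
open import Data.Product using (_×_; _,_; Σ; ∃)
open import Data.Sum using (_⊎_)
open import Relation.Nullary using (¬_; Dec)
open import Relation.Nullary.Decidable using (⌊_⌋)
open import Relation.Binary.PropositionalEquality using (_≡_; _≢_)

record Graph (n : ℕ) : Set₁ where
  field
    Adj    : Fin n → Fin n → Set
    adj?   : ∀ u v → Dec (Adj u v)
    sym    : ∀ {u v} → Adj u v → Adj v u
    irrefl : ∀ {u} → ¬ Adj u u
open Graph public

degree : ∀ {n} → Graph n → Fin n → ℕ
degree {n} G v = length (filter (adj? G v) (allFin n))

MinDegHalf : ∀ {n} → Graph n → Set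
MinDegHalf {n} G = ∀ v → n ≤ 2 * degree G v

IsPath : ∀ {n} → Graph n → List (Fin n) → Set
IsPath G P = P ≢ [] × Unique P × Linked (Adj G) P

PathFromTo : ∀ {n} → Graph n → List (Fin n) → Fin n → Fin n → Set
PathFromTo G P a b = IsPath G P × head P ≡ just a × last P ≡ just b

isPathEdge : ∀ {n} → List (Fin n) → Fin n → Fin n → Bool
isPathEdge (x ∷ y ∷ rest) u v =
  ((⌊ x ≟ u ⌋ ∧ ⌊ y ≟ v ⌋) ∨ (⌊ x ≟ v ⌋ ∧ ⌊ y ≟ u ⌋)) ∨ isPathEdge (y ∷ rest) u v
isPathEdge _ u v = false

allPairs : ∀ n → List (Fin n × Fin n)
allPairs n = concatMap (λ u → map (λ v → (u , v)) (allFin n)) (allFin n)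

-- |E(P) Δ E(Q)|: unordered pairs {u,v} (counted once via toℕ u < toℕ v)
-- lying in exactly one of E(P), E(Q)
symDiffSize : ∀ {n} → List (Fin n) → List (Fin n) → ℕ
symDiffSize {n} P Q = length (filterᵇ keep (allPairs n))
  where
  keep : Fin n × Fin n → Bool
  keep (u , v) = ⌊ toℕ u <? toℕ v ⌋ ∧ (isPathEdge P u v xor isPathEdge Q u v)

-- adding the edge ab to the a–b path P gives a Hamilton cycle of G:
-- ab ∈ E(G), P covers all vertices, and P has ≥ 3 vertices (so P + ab is a cycle)
ClosesToHamiltonCycle : ∀ {n} → Graph n → List (Fin n) → Fin n → Fin n → Set
ClosesToHamiltonCycle {n} G P a b = Adj G a b × (∀ v → v ∈ P) × 3 ≤ length P

EdgeOut : ∀ {n} → Graph n → List (Fin n) → Fin n → Fin n → Set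
EdgeOut {n} G P a b = Σ (Fin n) λ u → Σ (Fin n) λ w → (u ≡ a ⊎ u ≡ b) × w ∉ P × Adj G u w

module Submission where

-- Let P₀ run from v₁ to vₖ.  If an end of P₀ has a neighbour off P₀, the
-- path P* = P₀ itself will do.  Otherwise N(v₁) and N(vₖ) lie on P₀, and as
-- deg v₁ + deg vₖ ≥ n ≥ |P₀| a pigeonhole count over consecutive pairs cuts
-- P₀ = X ++ Y with vₖ ~ last X and v₁ ~ head Y.  Reversing Y turns P₀ into a
-- path C from v₁ to head Y that closes into a cycle on V(P₀); only the edges
-- at the cut change, so |E(P₀) Δ E(C)| ≤ 2.  If C covers V(G) it is the
-- Hamilton path we want.  Otherwise an outside vertex w has, by Dirac's
-- condition, a common neighbour z with v₁, and z lies on P₀; cutting the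
-- cycle open at z changes at most two further edges and yields P* with the
-- edge zw leaving it.

open import Defs hiding (sym)
open import Data.Nat using (ℕ; suc; _≤_; _<_; _+_; _*_; z≤n; s≤s; _<?_)
open import Data.Nat.Properties
  using ( ≤-trans; ≤-pred; +-suc; n≤1+n; +-mono-≤; +-monoʳ-≤; +-identityʳ; +-comm; ≤-total; <-asym
        ; 1+n≰n; n≤0⇒n≡0; m≤m+n; module ≤-Reasoning)
open import Data.Fin using (Fin; toℕ; _≟_)
open import Data.Fin.Properties using (any?)
open import Data.Bool using (Bool; true; false; T; _∧_; _∨_; _xor_)
open import Data.Bool.Properties using (T-∧; T-∨; ∨-assoc; ∨-comm; ∨-identityʳ; ∧-comm; xor-same)
open import Data.List
  using ( List; []; _∷_; _++_; [_]; length; filter; filterᵇ; allFin; head; last; reverse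
        ; concatMap; map; cartesianProduct)
open import Data.List.Properties
  using (length-++; length-tabulate; ++-identityʳ; unfold-reverse; reverse-involutive; ++-conicalʳ)
open import Data.List.Membership.Propositional using (_∈_; _∉_)
open import Data.List.Membership.Propositional.Properties
  using (∈-filter⁻; ∈-filter⁺; ∈-allFin; ∈-++⁻; ∈-++⁺ˡ; ∈-++⁺ʳ; ∈-∃++; ∈-cartesianProduct⁺)
open import Data.List.Relation.Binary.Subset.Propositional using (_⊆_)
open import Data.List.Relation.Unary.Any using (here; there)
import Data.List.Relation.Unary.All as All
open import Data.List.Relation.Unary.All.Properties using (¬Any⇒All¬)
open import Data.List.Relation.Unary.Unique.Propositional using (Unique; []; _∷_)
open import Data.List.Relation.Unary.Unique.Propositional.Properties
  using (filter⁺; allFin⁺; cartesianProduct⁺)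
import Data.List.Relation.Unary.Unique.Propositional.Properties as Unique
open import Data.List.Relation.Unary.Linked using (Linked; []; [-]; _∷_)
import Data.List.Relation.Unary.Linked as Linked
import Data.List.Relation.Unary.Linked.Properties as Linked
open import Data.List.Relation.Binary.Permutation.Propositional using (_↭_; ↭-refl; ↭-sym; ↭-trans; ↭⇒↭ₛ)
open import Data.List.Relation.Binary.Permutation.Propositional.Properties
  using (∈-resp-↭; ↭-length; shift; ++⁺ˡ; ++-comm; ↭-reverse; ↭-empty-inv)
import Data.List.Relation.Binary.Permutation.Setoid.Properties as PermutationSetoid
open import Data.Maybe using (Maybe; just; nothing)
open import Data.Maybe.Relation.Binary.Connected using (Connected; just)
open import Data.Product using (_×_; _,_; Σ; ∃; proj₁; proj₂)
import Data.Product as Product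
open import Data.Sum using (_⊎_; inj₁; inj₂)
import Data.Sum as Sum
open import Data.Empty using (⊥-elim)
open import Data.Unit using (tt)
open import Function.Base using (_∘_; id)
open import Function.Bundles using (_⇔_; mk⇔; Equivalence)
open import Relation.Binary.Core using (Rel)
open import Relation.Binary.Definitions using (Symmetric)
open import Relation.Binary.PropositionalEquality
  using (_≡_; _≢_; refl; sym; trans; cong; cong₂; subst; subst₂; setoid; module ≡-Reasoning)
open import Relation.Nullary using (¬_; yes; no; ¬?; contradiction)
open import Relation.Nullary.Decidable using (⌊_⌋; T?; toWitness; fromWitness; decidable-stable; _×-dec_)
open import Relation.Unary using (Pred; Decidable)
open import Level using (0ℓ)

module _ {A : Set} where

  unique-⊆-length : {xs ys : List A} → Unique xs → xs ⊆ ys → length xs ≤ length ys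
  unique-⊆-length {[]} _ _ = z≤n
  unique-⊆-length {x ∷ xs} (x∉xs ∷ unique) xs⊆ys
    with ys₁ , ys₂ , refl ← ∈-∃++ (xs⊆ys (here refl)) = begin
      suc (length xs)            ≤⟨ s≤s (unique-⊆-length unique rest) ⟩
      suc (length (ys₁ ++ ys₂))  ≡⟨ ↭-length (↭-sym (shift x ys₁ ys₂)) ⟩
      length (ys₁ ++ x ∷ ys₂)    ∎
    where
    open ≤-Reasoning
    -- every element of xs differs from x, so it survives removing x
    rest : xs ⊆ ys₁ ++ ys₂
    rest z∈xs with ∈-resp-↭ (shift x ys₁ ys₂) (xs⊆ys (there z∈xs))
    ... | here refl   = ⊥-elim (All.lookup x∉xs z∈xs refl)
    ... | there z∈ys = z∈ys

  unique-resp-↭ : {xs ys : List A} → xs ↭ ys → Unique xs → Unique ys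
  unique-resp-↭ xs↭ys = PermutationSetoid.Unique-resp-↭ (setoid A) (↭⇒↭ₛ xs↭ys)

  count : {P : Pred A 0ℓ} → Decidable P → List A → ℕ
  count P? xs = length (filter P? xs)

  head-++ : ∀ (xs : List A) {ys} → xs ≢ [] → head (xs ++ ys) ≡ head xs
  head-++ []       xs≢[] = ⊥-elim (xs≢[] refl)
  head-++ (x ∷ xs) _     = refl

  last-++ : ∀ (xs : List A) {ys} → ys ≢ [] → last (xs ++ ys) ≡ last ys
  last-++ []                       _     = refl
  last-++ (x ∷ [])      {[]}       ys≢[] = ⊥-elim (ys≢[] refl)
  last-++ (x ∷ [])      {_ ∷ _}    _     = refl
  last-++ (x ∷ x′ ∷ xs)            ys≢[] = last-++ (x′ ∷ xs) ys≢[]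

  last-reverse : ∀ (xs : List A) → last (reverse xs) ≡ head xs
  last-reverse []       = refl
  last-reverse (x ∷ xs) = begin
    last (reverse (x ∷ xs))     ≡⟨ cong last (unfold-reverse x xs) ⟩
    last (reverse xs ++ [ x ])  ≡⟨ last-++ (reverse xs) (λ ()) ⟩
    just x                      ∎
    where open ≡-Reasoning

  head-reverse : ∀ (xs : List A) → head (reverse xs) ≡ last xs
  head-reverse xs = begin
    head (reverse xs)            ≡⟨ sym (last-reverse (reverse xs)) ⟩
    last (reverse (reverse xs))  ≡⟨ cong last (reverse-involutive xs) ⟩
    last xs                      ∎
    where open ≡-Reasoning

  head-∈ : ∀ (xs : List A) {z} → head xs ≡ just z → z ∈ xs
  head-∈ (x ∷ xs) refl = here refl

  last-∈ : ∀ (xs : List A) {z} → last xs ≡ just z → z ∈ xs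
  last-∈ (x ∷ [])     refl = here refl
  last-∈ (x ∷ y ∷ ys) eq   = there (last-∈ (y ∷ ys) eq)

  last-just : ∀ (x : A) xs → ∃ λ z → last (x ∷ xs) ≡ just z
  last-just x []       = x , refl
  last-just x (y ∷ ys) = last-just y ys

  module _ {R : Rel A 0ℓ} where

    Linked-++ˡ : ∀ xs {ys} → Linked R (xs ++ ys) → Linked R xs
    Linked-++ˡ []            _        = []
    Linked-++ˡ (x ∷ [])      _        = [-]
    Linked-++ˡ (x ∷ x′ ∷ xs) (r ∷ rs) = r ∷ Linked-++ˡ (x′ ∷ xs) rs

    Linked-++ʳ : ∀ xs {ys} → Linked R (xs ++ ys) → Linked R ys
    Linked-++ʳ []       rs = rs
    Linked-++ʳ (x ∷ xs) rs = Linked-++ʳ xs (Linked.tail rs)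

    Linked-reverse : Symmetric R → ∀ {xs} → Linked R xs → Linked R (reverse xs)
    Linked-reverse R-sym {[]}         _        = []
    Linked-reverse R-sym {x ∷ []}     _        = [-]
    Linked-reverse R-sym {x ∷ y ∷ ys} (r ∷ rs) =
      subst (Linked R) (sym (unfold-reverse x (y ∷ ys)))
        (Linked.++⁺ (Linked-reverse R-sym rs) back [-])
      where
      back : Connected R (last (reverse (y ∷ ys))) (just x)
      back = subst (λ m → Connected R m (just x)) (sym (last-reverse (y ∷ ys))) (just (R-sym r))

    Linked-rotate : ∀ xs ys → Linked R (xs ++ ys) →
      Connected R (last (xs ++ ys)) (head (xs ++ ys)) → Linked R (ys ++ xs)
    Linked-rotate []       ys       rs _ = subst (Linked R) (sym (++-identityʳ ys)) rs
    Linked-rotate (x ∷ xs) []       rs _ = subst (Linked R) (++-identityʳ (x ∷ xs)) rs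
    Linked-rotate (x ∷ xs) (y ∷ ys) rs closed =
      Linked.++⁺ (Linked-++ʳ (x ∷ xs) rs)
        (subst (λ m → Connected R m (just x)) (last-++ (x ∷ xs) (λ ())) closed)
        (Linked-++ˡ (x ∷ xs) rs)

  module _ {Q P : Pred A 0ℓ} (Q? : Decidable Q) (P? : Decidable P) where

    ConsecutivePair : List A → Set
    ConsecutivePair xs = ∃ λ L → ∃ λ a → ∃ λ b → ∃ λ R →
      (xs ≡ (L ++ [ a ]) ++ b ∷ R) × Q a × P b

    private
      prepend : ∀ x {xs} → ConsecutivePair xs → ConsecutivePair (x ∷ xs)
      prepend x (L , a , b , R , eq , qa , pb) = x ∷ L , a , b , R , cong (x ∷_) eq , qa , pb

    -- Pigeonhole along a list: the |xs| consecutive pairs of x ∷ xs are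
    -- outnumbered by the Q-elements of x ∷ xs (whose last element fails Q)
    -- plus the P-elements of xs, so some pair (a , b) has Q a and P b.
    consecutive-pair : ∀ x xs → (∀ {z} → last (x ∷ xs) ≡ just z → ¬ Q z) →
      length xs < count Q? (x ∷ xs) + count P? xs → ConsecutivePair (x ∷ xs)
    consecutive-pair x [] ¬Q-last bound with Q? x
    ... | yes qx = ⊥-elim (¬Q-last refl qx)
    ... | no _   = contradiction bound λ ()
    consecutive-pair x (y ∷ ys) ¬Q-last bound with Q? x | P? y
    ... | yes qx | yes py = [] , x , y , ys , refl , qx , py
    ... | yes _  | no _   = prepend x (consecutive-pair y ys ¬Q-last (≤-pred bound))
    ... | no _   | yes _  = prepend x (consecutive-pair y ys ¬Q-last (≤-pred bound′))
      where
      bound′ : suc (suc (length ys)) ≤ suc (count Q? (y ∷ ys) + count P? ys)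
      bound′ = subst (suc (suc (length ys)) ≤_) (+-suc (count Q? (y ∷ ys)) (count P? ys)) bound
    ... | no _   | no _   = prepend x (consecutive-pair y ys ¬Q-last (≤-trans (n≤1+n _) bound))

-- If n ≤ 2a and n ≤ 2b then n ≤ a + b (the smaller of a, b is ≥ n/2).
half-sum : ∀ {n} a b → n ≤ 2 * a → n ≤ 2 * b → n ≤ a + b
half-sum {n} a b n≤2a n≤2b with ≤-total a b
... | inj₁ a≤b = ≤-trans n≤2a (+-monoʳ-≤ a (subst (_≤ b) (sym (+-identityʳ a)) a≤b))
... | inj₂ b≤a = subst (n ≤_) (+-comm b a)
                   (≤-trans n≤2b (+-monoʳ-≤ b (subst (_≤ a) (sym (+-identityʳ b)) b≤a)))

xor-∨-cancel : ∀ a c d → T ((a ∨ c) xor (a ∨ d)) → T c ⊎ T d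
xor-∨-cancel true  _     _ ()
xor-∨-cancel false true  _ _ = inj₁ tt
xor-∨-cancel false false _ t = inj₂ t

xor-split : ∀ p q r → T (p xor r) → T (p xor q) ⊎ T (q xor r)
xor-split true  true  r t = inj₂ t
xor-split true  false r _ = inj₁ tt
xor-split false true  r _ = inj₁ tt
xor-split false false r t = inj₂ t

module _ {n : ℕ} where

  -- sameEdge s t u v: the unordered pairs {s,t} and {u,v} coincide;
  -- isPathEdge tests each pair of consecutive path vertices this way.
  sameEdge : Fin n → Fin n → Fin n → Fin n → Bool
  sameEdge s t u v = (⌊ s ≟ u ⌋ ∧ ⌊ t ≟ v ⌋) ∨ (⌊ s ≟ v ⌋ ∧ ⌊ t ≟ u ⌋)

  sameEdge-sym : ∀ s t u v → sameEdge t s u v ≡ sameEdge s t u v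
  sameEdge-sym s t u v = begin
    (⌊ t ≟ u ⌋ ∧ ⌊ s ≟ v ⌋) ∨ (⌊ t ≟ v ⌋ ∧ ⌊ s ≟ u ⌋)
      ≡⟨ ∨-comm (⌊ t ≟ u ⌋ ∧ ⌊ s ≟ v ⌋) _ ⟩
    (⌊ t ≟ v ⌋ ∧ ⌊ s ≟ u ⌋) ∨ (⌊ t ≟ u ⌋ ∧ ⌊ s ≟ v ⌋)
      ≡⟨ cong₂ _∨_ (∧-comm ⌊ t ≟ v ⌋ _) (∧-comm ⌊ t ≟ u ⌋ _) ⟩
    (⌊ s ≟ u ⌋ ∧ ⌊ t ≟ v ⌋) ∨ (⌊ s ≟ v ⌋ ∧ ⌊ t ≟ u ⌋) ∎
    where open ≡-Reasoning

  ≟-∧-sound : ∀ {x y z w : Fin n} → T (⌊ x ≟ y ⌋ ∧ ⌊ z ≟ w ⌋) → x ≡ y × z ≡ w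
  ≟-∧-sound {x} {y} {z} {w} p =
    Product.map (toWitness {a? = x ≟ y}) (toWitness {a? = z ≟ w}) (Equivalence.to (T-∧ {⌊ x ≟ y ⌋}) p)

  sameEdge-sound : ∀ {s t u v} → T (sameEdge s t u v) → (s ≡ u × t ≡ v) ⊎ (s ≡ v × t ≡ u)
  sameEdge-sound {s} {t} {u} {v} same =
    Sum.map ≟-∧-sound ≟-∧-sound (Equivalence.to (T-∨ {⌊ s ≟ u ⌋ ∧ ⌊ t ≟ v ⌋}) same)

  edgeBetween : Maybe (Fin n) → Maybe (Fin n) → Fin n → Fin n → Bool
  edgeBetween (just s) (just t) = sameEdge s t
  edgeBetween _        _        = λ _ _ → false

  junction : List (Fin n) → List (Fin n) → Fin n → Fin n → Bool
  junction xs ys = edgeBetween (last xs) (head ys)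

  isPathEdge-++ : ∀ xs ys u v →
    isPathEdge (xs ++ ys) u v ≡ (isPathEdge xs u v ∨ isPathEdge ys u v) ∨ junction xs ys u v
  isPathEdge-++ []            ys       u v = sym (∨-identityʳ _)
  isPathEdge-++ (x ∷ [])      []       u v = refl
  isPathEdge-++ (x ∷ [])      (y ∷ ys) u v = ∨-comm (sameEdge x y u v) _
  isPathEdge-++ (x ∷ x′ ∷ xs) ys       u v = begin
    e ∨ isPathEdge ((x′ ∷ xs) ++ ys) u v     ≡⟨ cong (e ∨_) (isPathEdge-++ (x′ ∷ xs) ys u v) ⟩
    e ∨ ((p ∨ q) ∨ j)                        ≡⟨ sym (∨-assoc e (p ∨ q) j) ⟩
    (e ∨ (p ∨ q)) ∨ j                        ≡⟨ cong (_∨ j) (sym (∨-assoc e p q)) ⟩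
    ((e ∨ p) ∨ q) ∨ j                        ∎
    where
    open ≡-Reasoning
    e = sameEdge x x′ u v
    p = isPathEdge (x′ ∷ xs) u v
    q = isPathEdge ys u v
    j = junction (x′ ∷ xs) ys u v

  isPathEdge-reverse : ∀ xs u v → isPathEdge (reverse xs) u v ≡ isPathEdge xs u v
  isPathEdge-reverse []           u v = refl
  isPathEdge-reverse (x ∷ [])     u v = refl
  isPathEdge-reverse (x ∷ y ∷ ys) u v = begin
    isPathEdge (reverse (x ∷ y ∷ ys)) u v
      ≡⟨ cong (λ zs → isPathEdge zs u v) (unfold-reverse x (y ∷ ys)) ⟩
    isPathEdge (reverse (y ∷ ys) ++ [ x ]) u v
      ≡⟨ isPathEdge-++ (reverse (y ∷ ys)) [ x ] u v ⟩
    (isPathEdge (reverse (y ∷ ys)) u v ∨ false) ∨ junction (reverse (y ∷ ys)) [ x ] u v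
      ≡⟨ cong₂ _∨_ (∨-identityʳ _) (cong (λ m → edgeBetween m (just x) u v) (last-reverse (y ∷ ys))) ⟩
    isPathEdge (reverse (y ∷ ys)) u v ∨ sameEdge y x u v
      ≡⟨ cong₂ _∨_ (isPathEdge-reverse (y ∷ ys) u v) (sameEdge-sym x y u v) ⟩
    isPathEdge (y ∷ ys) u v ∨ sameEdge x y u v
      ≡⟨ ∨-comm (isPathEdge (y ∷ ys) u v) _ ⟩
    sameEdge x y u v ∨ isPathEdge (y ∷ ys) u v ∎
    where open ≡-Reasoning

  edgeKey : Fin n → Fin n → Fin n × Fin n
  edgeKey s t with toℕ s <? toℕ t
  ... | yes _ = s , t
  ... | no _  = t , s

  sameEdge-key : ∀ {s t u v} → T (sameEdge s t u v) → toℕ u < toℕ v → (u , v) ≡ edgeKey s t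
  sameEdge-key {s} {t} {u} {v} same u<v with sameEdge-sound {s} {t} {u} {v} same
  ... | inj₁ (refl , refl) with toℕ s <? toℕ t
  ...   | yes _   = refl
  ...   | no  s≮t = contradiction u<v s≮t
  sameEdge-key {s} {t} {u} {v} same u<v | inj₂ (refl , refl) with toℕ s <? toℕ t
  ...   | yes s<t = contradiction s<t (<-asym u<v)
  ...   | no  _   = refl

  junctionKeys : List (Fin n) → List (Fin n) → List (Fin n × Fin n)
  junctionKeys xs ys = keys (last xs) (head ys)
    where
    keys : Maybe (Fin n) → Maybe (Fin n) → List (Fin n × Fin n)
    keys (just s) (just t) = [ edgeKey s t ]
    keys _        _        = []

  junctionKeys-length : ∀ xs ys → length (junctionKeys xs ys) ≤ 1
  junctionKeys-length xs ys with last xs | head ys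
  ... | just _  | just _  = s≤s z≤n
  ... | just _  | nothing = z≤n
  ... | nothing | _       = z≤n

  junction-key : ∀ xs ys {u v} → T (junction xs ys u v) → toℕ u < toℕ v → (u , v) ∈ junctionKeys xs ys
  junction-key xs ys j u<v with last xs | head ys
  ... | just s  | just t  = here (sameEdge-key j u<v)
  ... | just _  | nothing = ⊥-elim j
  ... | nothing | _       = ⊥-elim j

  allPairs-product : allPairs n ≡ cartesianProduct (allFin n) (allFin n)
  allPairs-product = go (allFin n)
    where
    go : ∀ xs → concatMap (λ u → map (u ,_) (allFin n)) xs ≡ cartesianProduct xs (allFin n)
    go []       = refl
    go (x ∷ xs) = cong (map (x ,_) (allFin n) ++_) (go xs)

  allPairs-unique : Unique (allPairs n)
  allPairs-unique = subst Unique (sym allPairs-product) (cartesianProduct⁺ (allFin⁺ n) (allFin⁺ n))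

  ∈-allPairs : ∀ u v → (u , v) ∈ allPairs n
  ∈-allPairs u v = subst ((u , v) ∈_) (sym allPairs-product) (∈-cartesianProduct⁺ (∈-allFin u) (∈-allFin v))

  changed : List (Fin n) → List (Fin n) → Fin n × Fin n → Bool
  changed P Q (u , v) = ⌊ toℕ u <? toℕ v ⌋ ∧ (isPathEdge P u v xor isPathEdge Q u v)

  changedKeys : List (Fin n) → List (Fin n) → List (Fin n × Fin n)
  changedKeys P Q = filterᵇ (changed P Q) (allPairs n)

  changedKeys⁻ : ∀ P Q {u v} → (u , v) ∈ changedKeys P Q →
    toℕ u < toℕ v × T (isPathEdge P u v xor isPathEdge Q u v)
  changedKeys⁻ P Q k∈ =
    let (u<v , d) = Equivalence.to T-∧ (proj₂ (∈-filter⁻ (T? ∘ changed P Q) {xs = allPairs n} k∈))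
    in toWitness u<v , d

  changedKeys⁺ : ∀ P Q {u v} → toℕ u < toℕ v → T (isPathEdge P u v xor isPathEdge Q u v) →
    (u , v) ∈ changedKeys P Q
  changedKeys⁺ P Q {u} {v} u<v d = ∈-filter⁺ _ (∈-allPairs u v) (Equivalence.from T-∧ (fromWitness u<v , d))

  symDiff-cover : ∀ P Q (S : List (Fin n × Fin n)) →
    (∀ {u v} → toℕ u < toℕ v → T (isPathEdge P u v xor isPathEdge Q u v) → (u , v) ∈ S) →
    symDiffSize P Q ≤ length S
  symDiff-cover P Q S covered =
    unique-⊆-length (filter⁺ _ allPairs-unique) λ k∈ → let (u<v , d) = changedKeys⁻ P Q k∈ in covered u<v d

  symDiff-self : ∀ P → symDiffSize P P ≡ 0
  symDiff-self P = n≤0⇒n≡0 (symDiff-cover P P [] λ {u} {v} _ d →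
    ⊥-elim (subst T (xor-same (isPathEdge P u v)) d))

  symDiff-triangle : ∀ P Q R → symDiffSize P R ≤ symDiffSize P Q + symDiffSize Q R
  symDiff-triangle P Q R =
    subst (symDiffSize P R ≤_) (length-++ (changedKeys P Q))
      (symDiff-cover P R (changedKeys P Q ++ changedKeys Q R) covered)
    where
    covered : ∀ {u v} → toℕ u < toℕ v → T (isPathEdge P u v xor isPathEdge R u v) →
      (u , v) ∈ changedKeys P Q ++ changedKeys Q R
    covered {u} {v} u<v d with xor-split (isPathEdge P u v) (isPathEdge Q u v) (isPathEdge R u v) d
    ... | inj₁ pq = ∈-++⁺ˡ (changedKeys⁺ P Q u<v pq)
    ... | inj₂ qr = ∈-++⁺ʳ (changedKeys P Q) (changedKeys⁺ Q R u<v qr)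

  symDiff-junctions : ∀ P Q A B A′ B′ →
    (∀ u v → T (isPathEdge P u v xor isPathEdge Q u v) → T (junction A B u v) ⊎ T (junction A′ B′ u v)) →
    symDiffSize P Q ≤ 2
  symDiff-junctions P Q A B A′ B′ only-junctions =
    ≤-trans (symDiff-cover P Q (junctionKeys A B ++ junctionKeys A′ B′) covered)
      (subst (_≤ 2) (sym (length-++ (junctionKeys A B)))
        (+-mono-≤ (junctionKeys-length A B) (junctionKeys-length A′ B′)))
    where
    covered : ∀ {u v} → toℕ u < toℕ v → T (isPathEdge P u v xor isPathEdge Q u v) →
      (u , v) ∈ junctionKeys A B ++ junctionKeys A′ B′
    covered {u} {v} u<v d with only-junctions u v d
    ... | inj₁ j = ∈-++⁺ˡ (junction-key A B j u<v)
    ... | inj₂ j = ∈-++⁺ʳ (junctionKeys A B) (junction-key A′ B′ j u<v)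

  symDiff-reverse-suffix : ∀ xs ys → symDiffSize (xs ++ ys) (xs ++ reverse ys) ≤ 2
  symDiff-reverse-suffix xs ys = symDiff-junctions (xs ++ ys) (xs ++ reverse ys) xs ys xs (reverse ys) λ u v d →
    xor-∨-cancel (isPathEdge xs u v ∨ isPathEdge ys u v) _ _
      (subst₂ (λ p q → T (p xor q)) (isPathEdge-++ xs ys u v)
        (trans (isPathEdge-++ xs (reverse ys) u v)
          (cong (λ e → (isPathEdge xs u v ∨ e) ∨ junction xs (reverse ys) u v) (isPathEdge-reverse ys u v)))
        d)

  symDiff-rotate : ∀ xs ys → symDiffSize (xs ++ ys) (ys ++ xs) ≤ 2
  symDiff-rotate xs ys = symDiff-junctions (xs ++ ys) (ys ++ xs) xs ys ys xs λ u v d →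
    xor-∨-cancel (isPathEdge xs u v ∨ isPathEdge ys u v) _ _
      (subst₂ (λ p q → T (p xor q)) (isPathEdge-++ xs ys u v)
        (trans (isPathEdge-++ ys xs u v)
          (cong (_∨ junction ys xs u v) (∨-comm (isPathEdge ys u v) (isPathEdge xs u v))))
        d)

module _ {n : ℕ} (G : Graph n) where
  open import Data.List.Membership.DecPropositional (_≟_ {n}) using (_∈?_)

  neighbours : Fin n → List (Fin n)
  neighbours v = filter (adj? G v) (allFin n)

  neighbours⁻ : ∀ {v w} → w ∈ neighbours v → Adj G v w
  neighbours⁻ w∈ = proj₂ (∈-filter⁻ (adj? G _) {xs = allFin n} w∈)

  unique-length-≤ : ∀ {xs} → Unique xs → length xs ≤ n
  unique-length-≤ {xs} unique =
    subst (length xs ≤_) (length-tabulate {n = n} id)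
      (unique-⊆-length {ys = allFin n} unique λ {x} _ → ∈-allFin x)

  covering-length : ∀ {xs} → (∀ v → v ∈ xs) → n ≤ length xs
  covering-length {xs} covers =
    subst (_≤ length xs) (length-tabulate {n = n} id)
      (unique-⊆-length {xs = allFin n} (allFin⁺ n) λ {x} _ → covers x)

  degree-≤-count : ∀ {v xs} → (∀ w → Adj G v w → w ∈ xs) → degree G v ≤ count (adj? G v) xs
  degree-≤-count {v} N⊆xs = unique-⊆-length (filter⁺ (adj? G v) (allFin⁺ n)) λ w∈ →
    ∈-filter⁺ (adj? G v) (N⊆xs _ (neighbours⁻ w∈)) (neighbours⁻ w∈)

  neighbour-off? : ∀ x P → (∃ λ w → w ∉ P × Adj G x w) ⊎ (∀ w → Adj G x w → w ∈ P)
  neighbour-off? x P with any? (λ w → ¬? (w ∈? P) ×-dec adj? G x w)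
  ... | yes found = inj₁ found
  ... | no  none  = inj₂ λ w xw → decidable-stable (w ∈? P) λ w∉P → none (w , w∉P , xw)

  covers? : ∀ P → (∀ v → v ∈ P) ⊎ (∃ λ w → w ∉ P)
  covers? P with any? (λ w → ¬? (w ∈? P))
  ... | yes found = inj₂ found
  ... | no  none  = inj₁ λ v → decidable-stable (v ∈? P) λ v∉P → none (v , v∉P)

  -- Under Dirac's condition two distinct non-adjacent vertices u, w have a
  -- common neighbour: otherwise u, w, N(u), N(w) would be n + 2 distinct
  -- vertices.
  common-neighbour : MinDegHalf G → ∀ {u w} → u ≢ w → ¬ Adj G u w → ∃ λ z → Adj G u z × Adj G w z
  common-neighbour δ {u} {w} u≢w u≁w with any? (λ z → adj? G u z ×-dec adj? G w z)
  ... | yes found = found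
  ... | no  none  = contradiction (unique-length-≤ {u ∷ w ∷ Nu ++ Nw} distinct) too-many
    where
    Nu = neighbours u
    Nw = neighbours w
    u∉ : u ∉ w ∷ Nu ++ Nw
    u∉ (here u≡w) = u≢w u≡w
    u∉ (there u∈) with ∈-++⁻ Nu u∈
    ... | inj₁ u∈Nu = irrefl G (neighbours⁻ u∈Nu)
    ... | inj₂ u∈Nw = u≁w (Graph.sym G (neighbours⁻ u∈Nw))
    w∉ : w ∉ Nu ++ Nw
    w∉ w∈ with ∈-++⁻ Nu w∈
    ... | inj₁ w∈Nu = u≁w (neighbours⁻ w∈Nu)
    ... | inj₂ w∈Nw = irrefl G (neighbours⁻ w∈Nw)
    distinct : Unique (u ∷ w ∷ Nu ++ Nw)
    distinct = ¬Any⇒All¬ _ u∉ ∷ ¬Any⇒All¬ _ w∉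
      ∷ Unique.++⁺ (filter⁺ (adj? G u) (allFin⁺ n)) (filter⁺ (adj? G w) (allFin⁺ n))
          (λ (z∈Nu , z∈Nw) → none (_ , neighbours⁻ z∈Nu , neighbours⁻ z∈Nw))
    too-many : ¬ (suc (suc (length (Nu ++ Nw))) ≤ n)
    too-many bound = 1+n≰n (≤-trans (n≤1+n (suc n)) (≤-trans (s≤s (s≤s degrees)) bound))
      where
      degrees : n ≤ length (Nu ++ Nw)
      degrees = subst (n ≤_) (sym (length-++ Nu)) (half-sum (degree G u) (degree G w) (δ u) (δ w))

  neighbour-on : MinDegHalf G → ∀ {v w P} → v ∈ P → (∀ z → Adj G v z → z ∈ P) → w ∉ P →
    ∃ λ z → z ∈ P × Adj G z w
  neighbour-on δ {v} {w} v∈P N⊆P w∉P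
    with common-neighbour δ {v} {w} (λ { refl → w∉P v∈P }) (λ vw → w∉P (N⊆P w vw))
  ... | z , vz , wz = z , N⊆P z vz , Graph.sym G wz

Rerouting : ∀ {n} → Graph n → List (Fin n) → Set
Rerouting {n} G P₀ = Σ (Fin n) λ a → Σ (Fin n) λ b → Σ (List (Fin n)) λ P* →
  a ∈ P₀ × b ∈ P₀ × PathFromTo G P* a b × (∀ v → (v ∈ P* ⇔ v ∈ P₀)) ×
  symDiffSize P₀ P* ≤ 4 × (ClosesToHamiltonCycle G P* a b ⊎ EdgeOut G P* a b)

module _ {n : ℕ} (G : Graph n) where

  endpoints : ∀ {P} → IsPath G P → ∃ λ a → ∃ λ b → PathFromTo G P a b
  endpoints {[]}     (P≢[] , _) = ⊥-elim (P≢[] refl)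
  endpoints {x ∷ xs} isPath     = let (b , ends-at-b) = last-just x xs in x , b , isPath , refl , ends-at-b

  ends-∈ : ∀ {P a b} → PathFromTo G P a b → a ∈ P × b ∈ P
  ends-∈ {P} (_ , starts-at-a , ends-at-b) = head-∈ P starts-at-a , last-∈ P ends-at-b

  rearranged-path : ∀ {P Q} → IsPath G P → Q ↭ P → Linked (Adj G) Q → IsPath G Q
  rearranged-path (P≢[] , uniqueP , _) Q↭P linked =
    (λ { refl → P≢[] (↭-empty-inv (↭-sym Q↭P)) }) , unique-resp-↭ (↭-sym Q↭P) uniqueP , linked

  rerouting : ∀ {P₀ P* a b} → PathFromTo G P* a b → P* ↭ P₀ → symDiffSize P₀ P* ≤ 4 →
    ClosesToHamiltonCycle G P* a b ⊎ EdgeOut G P* a b → Rerouting G P₀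
  rerouting {P* = P*} {a} {b} path P*↭P₀ few outcome =
    a , b , P* , ∈-resp-↭ P*↭P₀ (proj₁ (ends-∈ path)) , ∈-resp-↭ P*↭P₀ (proj₂ (ends-∈ path)) ,
    path ,
    (λ v → mk⇔ (∈-resp-↭ P*↭P₀) (∈-resp-↭ (↭-sym P*↭P₀))) , few , outcome

  unchanged-rerouting : ∀ {P₀ a b} → PathFromTo G P₀ a b → EdgeOut G P₀ a b → Rerouting G P₀
  unchanged-rerouting {P₀} path out =
    rerouting path ↭-refl (subst (_≤ 4) (sym (symDiff-self P₀)) z≤n) (inj₂ out)

  record CycleRerouting (P₀ : List (Fin n)) : Set where
    field
      C          : List (Fin n)
      start end  : Fin n
      path       : PathFromTo G C start end
      closing    : Adj G end start
      vertices   : C ↭ P₀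
      changes    : symDiffSize P₀ C ≤ 2

  reverse-tail : ∀ {v₁ vₖ a b} L R → PathFromTo G ((L ++ [ a ]) ++ b ∷ R) v₁ vₖ →
    Adj G vₖ a → Adj G v₁ b → CycleRerouting ((L ++ [ a ]) ++ b ∷ R)
  reverse-tail {v₁} {vₖ} {a} {b} L R (isPath@(_ , _ , linked) , starts-at-v₁ , ends-at-vₖ) vₖa v₁b = record
    { C        = X ++ reverse Y
    ; start    = v₁
    ; end      = b
    ; path     = rearranged-path isPath C↭P₀ linkedC , starts-at-v₁′ , ends-at-b
    ; closing  = Graph.sym G v₁b
    ; vertices = C↭P₀
    ; changes  = symDiff-reverse-suffix X Y
    }
    where
    X = L ++ [ a ]
    Y = b ∷ R
    X≢[] : X ≢ []
    X≢[] X≡[] with ++-conicalʳ L [ a ] X≡[]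
    ... | ()
    reverse-Y≢[] : reverse Y ≢ []
    reverse-Y≢[] rY≡[] with subst (λ zs → last zs ≡ just b) rY≡[] (last-reverse Y)
    ... | ()
    C↭P₀ : X ++ reverse Y ↭ X ++ Y
    C↭P₀ = ++⁺ˡ X (↭-reverse Y)
    -- the new junction joins a = last X to vₖ = last Y = head (reverse Y)
    joint : Connected (Adj G) (last X) (head (reverse Y))
    joint = subst₂ (Connected (Adj G)) (sym (last-++ L (λ ())))
      (sym (trans (head-reverse Y) (trans (sym (last-++ X (λ ()))) ends-at-vₖ)))
      (just (Graph.sym G vₖa))
    linkedC : Linked (Adj G) (X ++ reverse Y)
    linkedC = Linked.++⁺ (Linked-++ˡ X linked) joint (Linked-reverse (Graph.sym G) (Linked-++ʳ X linked))
    starts-at-v₁′ : head (X ++ reverse Y) ≡ just v₁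
    starts-at-v₁′ = trans (head-++ X X≢[]) (trans (sym (head-++ X X≢[])) starts-at-v₁)
    ends-at-b : last (X ++ reverse Y) ≡ just b
    ends-at-b = trans (last-++ X reverse-Y≢[]) (last-reverse Y)

  -- Since deg v₁ + deg vₖ ≥ n ≥ |P₀|, some consecutive pair (a , b) of P₀
  -- has vₖ ~ a and v₁ ~ b.
  close-path : MinDegHalf G → ∀ {P₀ v₁ vₖ} → PathFromTo G P₀ v₁ vₖ →
    (∀ w → Adj G v₁ w → w ∈ P₀) → (∀ w → Adj G vₖ w → w ∈ P₀) → CycleRerouting P₀
  close-path δ {v₁ ∷ rest} {v₁} {vₖ} path@((_ , unique , _) , refl , ends-at-vₖ) N₁⊆P₀ Nₖ⊆P₀
    = cut (consecutive-pair (adj? G vₖ) (adj? G v₁) v₁ rest ¬vₖ~last enough)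
    where
    cut : ConsecutivePair (adj? G vₖ) (adj? G v₁) (v₁ ∷ rest) → CycleRerouting (v₁ ∷ rest)
    cut (L , a , b , R , P₀≡ , vₖa , v₁b) =
      subst CycleRerouting (sym P₀≡)
        (reverse-tail L R (subst (λ P → PathFromTo G P v₁ vₖ) P₀≡ path) vₖa v₁b)
    ¬vₖ~last : ∀ {z} → last (v₁ ∷ rest) ≡ just z → ¬ Adj G vₖ z
    ¬vₖ~last ends-at-z with trans (sym ends-at-vₖ) ends-at-z
    ... | refl = irrefl G
    N₁⊆rest : ∀ w → Adj G v₁ w → w ∈ rest
    N₁⊆rest w v₁w with N₁⊆P₀ w v₁w
    ... | here refl = ⊥-elim (irrefl G v₁w)
    ... | there w∈rest = w∈rest
    enough : length rest < count (adj? G vₖ) (v₁ ∷ rest) + count (adj? G v₁) rest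
    enough = begin
      length (v₁ ∷ rest)
        ≤⟨ unique-length-≤ G unique ⟩
      n
        ≤⟨ half-sum (degree G vₖ) (degree G v₁) (δ vₖ) (δ v₁) ⟩
      degree G vₖ + degree G v₁
        ≤⟨ +-mono-≤ (degree-≤-count G Nₖ⊆P₀) (degree-≤-count G N₁⊆rest) ⟩
      count (adj? G vₖ) (v₁ ∷ rest) + count (adj? G v₁) rest ∎
      where open ≤-Reasoning

  module _ {P₀ : List (Fin n)} (cycle : CycleRerouting P₀) where
    open CycleRerouting cycle

    closed : Connected (Adj G) (last C) (head C)
    closed with path
    ... | _ , starts-at-start , ends-at-end =
      subst₂ (Connected (Adj G)) (sym ends-at-end) (sym starts-at-start) (just closing)

    hamiltonian-rerouting : 3 ≤ n → (∀ v → v ∈ P₀) → Rerouting G P₀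
    hamiltonian-rerouting 3≤n P₀-covers = rerouting path vertices (≤-trans changes (m≤m+n 2 2))
      (inj₁ (Graph.sym G closing , C-covers , ≤-trans 3≤n (covering-length G C-covers)))
      where
      C-covers : ∀ v → v ∈ C
      C-covers v = ∈-resp-↭ (↭-sym vertices) (P₀-covers v)

    -- Cutting the cycle open just before a vertex x gives a path starting at
    -- x; this changes at most two edges of C, hence at most four of P₀.
    open-at : ∀ {x} → x ∈ P₀ →
      ∃ λ P* → ∃ λ b → PathFromTo G P* x b × P* ↭ P₀ × symDiffSize P₀ P* ≤ 4
    open-at {x} x∈P₀ with ∈-∃++ (∈-resp-↭ (↭-sym vertices) x∈P₀)
    ... | A , B , C≡ = let (b , ends-at-b) = last-just x (B ++ A) in
      P* , b , (rearranged-path isPath P*↭C linked , refl , ends-at-b) , ↭-trans P*↭C vertices , few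
      where
      P* = (x ∷ B) ++ A
      isPath : IsPath G C
      isPath = proj₁ path
      linked : Linked (Adj G) P*
      linked = Linked-rotate A (x ∷ B) (subst (Linked (Adj G)) C≡ (proj₂ (proj₂ isPath)))
        (subst (λ zs → Connected (Adj G) (last zs) (head zs)) C≡ closed)
      P*↭C : P* ↭ C
      P*↭C = subst (P* ↭_) (sym C≡) (++-comm (x ∷ B) A)
      few : symDiffSize P₀ P* ≤ 4
      few = ≤-trans (symDiff-triangle P₀ C P*)
        (+-mono-≤ changes (subst (λ zs → symDiffSize zs P* ≤ 2) (sym C≡) (symDiff-rotate A (x ∷ B))))

    escaping-rerouting : ∀ {x w} → x ∈ P₀ → w ∉ P₀ → Adj G x w → Rerouting G P₀
    escaping-rerouting {x} {w} x∈P₀ w∉P₀ xw with open-at x∈P₀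
    ... | P* , b , path* , P*↭P₀ , few =
      rerouting path* P*↭P₀ few
        (inj₂ (x , w , inj₁ refl , (λ w∈P* → w∉P₀ (∈-resp-↭ P*↭P₀ w∈P*)) , xw))

lemma2p10 : (n : ℕ) → 3 ≤ n → (G : Graph n) → MinDegHalf G →
    (P₀ : List (Fin n)) → IsPath G P₀ →
    Σ (Fin n) λ a → Σ (Fin n) λ b → Σ (List (Fin n)) λ P* →
    a ∈ P₀ × b ∈ P₀ × PathFromTo G P* a b ×
    (∀ v → (v ∈ P* ⇔ v ∈ P₀)) ×
    symDiffSize P₀ P* ≤ 4 ×
    (ClosesToHamiltonCycle G P* a b ⊎ EdgeOut G P* a b)
lemma2p10 n 3≤n G δ P₀ isPath with endpoints G isPath
... | v₁ , vₖ , path with neighbour-off? G v₁ P₀ | neighbour-off? G vₖ P₀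
...   | inj₁ (w , w∉P₀ , v₁w) | _ = unchanged-rerouting G path (v₁ , w , inj₁ refl , w∉P₀ , v₁w)
...   | inj₂ _ | inj₁ (w , w∉P₀ , vₖw) = unchanged-rerouting G path (vₖ , w , inj₂ refl , w∉P₀ , vₖw)
...   | inj₂ N₁⊆P₀ | inj₂ Nₖ⊆P₀ with close-path G δ path N₁⊆P₀ Nₖ⊆P₀ | covers? G P₀
...     | cycle | inj₁ P₀-covers = hamiltonian-rerouting G cycle 3≤n P₀-covers
...     | cycle | inj₂ (w , w∉P₀) with neighbour-on G δ (proj₁ (ends-∈ G path)) N₁⊆P₀ w∉P₀
...       | z , z∈P₀ , zw = escaping-rerouting G cycle z∈P₀ w∉P₀ zw
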